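{- There is no $13$-cap of dimension $7$ in $\mathbb{Z}_2^n$ (for any $n$).
   Context: Work in $\mathbb{Z}_2^n$. The dimension of a subset $S$ is the dimension of its affine span $\operatorname{aff}(S)$, the smallest affine flat containing $S$ (equivalently, the set of all sums of an odd number of distinct elements of $S$). A quad is a set of four distinct elements summing to $\mathbf{0}$; a cap is a quad-free subset; a $k$-cap is a cap with $k$ elements. -}

module Defs where

open import Data.Bool using (Bool; true; false; _xor_)
open import Data.Nat using (ℕ; zero; suc; _%_)
open import Data.Fin using (Fin)
open import Data.Fin.Subset using (Subset; ∣_∣)
open import Data.Vec using (Vec; []; _∷_; zipWith; replicate; tabulate)
open import Data.Product using (Σ; ∃; ∃-syntax; _×_; _,_)
open import Data.Nat using (_≡ᵇ_)
open import Relation.Binary.PropositionalEquality using (_≡_; _≢_)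
open import Relation.Nullary using (¬_)
open import Function.Definitions using (Injective)

Z2^ : ℕ → Set
Z2^ n = Vec Bool n

_⊕_ : ∀ {n} → Z2^ n → Z2^ n → Z2^ n
_⊕_ = zipWith _xor_

𝟎 : ∀ {n} → Z2^ n
𝟎 {n} = replicate n false

selSum : ∀ {n k} → Subset k → Vec (Z2^ n) k → Z2^ n
selSum [] [] = 𝟎
selSum (true ∷ c) (v ∷ vs) = v ⊕ selSum c vs
selSum (false ∷ c) (v ∷ vs) = selSum c vs

-- A finite subset of Z_2^n with k elements, given as an injective indexing.
-- (S i are the elements; injectivity = the elements are distinct.)

IsCap : ∀ {n k} → (Fin k → Z2^ n) → Set
IsCap {n} {k} S =
  ∀ (a b c d : Fin k) → a ≢ b → a ≢ c → a ≢ d → b ≢ c → b ≢ d → c ≢ d →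
  ((S a ⊕ S b) ⊕ (S c ⊕ S d)) ≢ 𝟎

-- Affine span of S: all sums of an odd number of distinct elements of S.
InAff : ∀ {n k} → (Fin k → Z2^ n) → Z2^ n → Set
InAff {n} {k} S x = ∃[ c ] (∣ c ∣ % 2 ≡ 1 × selSum c (tabulate S) ≡ x)

InDir : ∀ {n k} → (Fin k → Z2^ n) → Z2^ n → Set
InDir S v = ∃[ x ] ∃[ y ] (InAff S x × InAff S y × (x ⊕ y) ≡ v)

LinIndep : ∀ {n d} → Vec (Z2^ n) d → Set
LinIndep {d = d} B = ∀ (c : Subset d) → selSum c B ≡ 𝟎 → c ≡ replicate d false

InSpan : ∀ {n d} → Vec (Z2^ n) d → Z2^ n → Set
InSpan {d = d} B v = ∃[ c ] (selSum {k = d} c B ≡ v)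

AffDim : ∀ {n k} → (Fin k → Z2^ n) → ℕ → Set
AffDim {n} S d =
  ∃[ B ] (LinIndep {n} {d} B × (∀ i → InDir S (Data.Vec.lookup B i))
          × (∀ v → InDir S v → InSpan B v))

IsKCap : ∀ {n} (k : ℕ) → (Fin k → Z2^ n) → Set
IsKCap k S = Injective _≡_ _≡_ S × IsCap S

-- Translating the cap so that its first point is 0 and taking coordinates with respect to a
-- basis of the direction space of its affine span turns a 13-cap of dimension 7 into twelve
-- distinct vectors of Z2^7 any at most four of which are linearly independent (a dependency
-- among them is a quad, or two equal points). Choosing a maximal independent subfamily, of
-- size r ≤ 7, as a new basis puts them in standard form: the r unit vectors together with
-- 12 − r further vectors Y in Z2^r. Any j distinct members of Y whose sum has weight w give
-- j + w dependent vectors, so j + w ≥ 5 whenever 1 ≤ j ≤ 4; in coding terms, Y would be the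
-- redundant part of a parity-check matrix of a binary linear [12, 12 − r, 5] code. An
-- exhaustive search over Z2^r, r ≤ 7, shows that no such Y exists.

module Submission where

open import Defs
open import Data.Nat using (ℕ)
open import Data.Fin using (Fin)
open import Relation.Nullary using (¬_)
open import Data.Product using (_×_)

open import Algebra.Bundles using (AbelianGroup)
open import Algebra.Structures using (IsAbelianGroup)
import Algebra.Properties.AbelianGroup as AbelianGroupProperties
import Algebra.Properties.CommutativeSemigroup as CommutativeSemigroupProperties
open import Data.Bool using (Bool; true; false; _∧_)
open import Data.Bool.Properties
  using (xor-assoc; xor-comm; xor-identityˡ; xor-identityʳ; xor-same; T?; ∧-conicalˡ; ∧-conicalʳ)
  renaming (_≟_ to _≟ᵇ_)
open import Data.Empty using (⊥)
open import Data.Fin using (zero; suc; _↑ˡ_; _↑ʳ_; splitAt)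
open import Data.Fin.Properties
  using (suc-injective; splitAt-↑ˡ; splitAt-↑ʳ; splitAt⁻¹-↑ˡ; splitAt⁻¹-↑ʳ)
  renaming (injective⇒≤ to Fin-injective⇒≤)
open import Data.Fin.Subset using (⁅_⁆)
open import Data.Fin.Subset.Properties using (∣⁅x⁆∣≡1)
open import Data.List using (List; []; _∷_; _++_; length; map; foldr; filter; tabulate)
open import Data.List.Properties
  using (length-map; length-++; length-++-≤ʳ; length-++-sucʳ; map-++; map-∘; length-tabulate)
open import Data.List.Membership.Propositional using (_∈_; lose)
open import Data.List.Membership.Propositional.Properties
  using (∈-map⁺; ∈-++⁺ˡ; ∈-++⁺ʳ; ∈-∃++; ∈-tabulate⁻; ∈-filter⁺)
open import Data.List.Relation.Binary.Subset.Propositional using (_⊆_)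
import Data.List.Relation.Binary.Subset.Propositional.Properties as Subset
open import Data.List.Relation.Unary.All as All using (All; []; _∷_; all?)
open import Data.List.Relation.Unary.All.Properties
  using () renaming (tabulate⁺ to All-tabulate⁺; map⁺ to All-map⁺)
open import Data.List.Relation.Unary.Any using (here; there; any?; satisfied)
open import Data.List.Relation.Unary.Unique.Propositional using (Unique; []; _∷_)
import Data.List.Relation.Unary.Unique.Propositional.Properties as Unique
open import Data.Nat using (zero; suc; _+_; _∸_; _%_; _≤_; _<_; _≤?_; z≤n; s≤s)
open import Data.Nat.Properties
  using (≤-refl; ≤-trans; ≤-pred; <⇒≱; ≰⇒>; +-mono-≤; m≤m+n; m+n∸m≡n)
  renaming (suc-injective to ℕ-suc-injective)
open import Data.Product using (∃; ∃₂; _,_; proj₁; proj₂)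
open import Data.Sum using (inj₁; inj₂; [_,_]′)
open import Data.Vec using (Vec; []; _∷_; fromList; toList; lookup; count)
import Data.Vec as Vec
open import Data.Vec.Properties
  using (zipWith-assoc; zipWith-comm; zipWith-identityˡ; zipWith-identityʳ; ≡-dec; ∷-injectiveʳ;
         toList∘fromList; lookup∘tabulate)
open import Function using (id; _∘_)
open import Function.Definitions using (Injective)
open import Level using (0ℓ)
open import Relation.Binary.Definitions using (DecidableEquality)
open import Relation.Binary.PropositionalEquality
open import Relation.Binary.PropositionalEquality.Algebra using (isMagma)
open import Relation.Nullary using (Dec; yes; no; ¬?; contradiction)
open import Relation.Nullary.Decidable using (map′; _×-dec_; _→-dec_)

-- Permutations are taken from the setoid library (at _≡_), which provides Unique-resp-↭.
module _ {A : Set} where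
  open import Data.List.Relation.Binary.Permutation.Setoid (setoid A) public
    using (_↭_; ↭-refl; ↭-sym; ↭-trans; ↭-prep)
  open import Data.List.Relation.Binary.Permutation.Setoid.Properties (setoid A) public
    using (Unique-resp-↭; ∈-resp-↭; xs↭ys⇒|xs|≡|ys|; ↭-shift; ++⁺ˡ)

preimage : ∀ {A B : Set} (f : A → B) {ys : List B} →
           All (λ y → ∃ λ x → f x ≡ y) ys → ∃ λ xs → map f xs ≡ ys
preimage f []               = [] , refl
preimage f ((x , refl) ∷ ps) = let xs , e = preimage f ps in x ∷ xs , cong (f x ∷_) e

unique-++-disjoint : ∀ {A : Set} (xs : List A) {ys} → Unique (xs ++ ys) →
                     ∀ {x y} → x ∈ xs → y ∈ ys → x ≢ y
unique-++-disjoint (_ ∷ xs) (x∉ ∷ _)   (here refl) y∈ = All.lookup x∉ (∈-++⁺ʳ xs y∈)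
unique-++-disjoint (_ ∷ xs) (_ ∷ uniq) (there x∈)  y∈ = unique-++-disjoint xs uniq x∈ y∈

unique-++ʳ : ∀ {A : Set} (xs : List A) {ys} → Unique (xs ++ ys) → Unique ys
unique-++ʳ []       uniq       = uniq
unique-++ʳ (_ ∷ xs) (_ ∷ uniq) = unique-++ʳ xs uniq

-- Z2^ n as an abelian group

⊕-self : ∀ {n} (x : Z2^ n) → x ⊕ x ≡ 𝟎
⊕-self []      = refl
⊕-self (b ∷ x) = cong₂ _∷_ (xor-same b) (⊕-self x)

⊕-isAbelianGroup : ∀ n → IsAbelianGroup _≡_ (_⊕_ {n}) 𝟎 id
⊕-isAbelianGroup n = record
  { isGroup = record
    { isMonoid = record
      { isSemigroup = record { isMagma = isMagma _⊕_ ; assoc = zipWith-assoc xor-assoc }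
      ; identity    = zipWith-identityˡ xor-identityˡ , zipWith-identityʳ xor-identityʳ
      }
    ; inverse = ⊕-self , ⊕-self
    ; ⁻¹-cong = cong id
    }
  ; comm = zipWith-comm xor-comm
  }

⊕-abelianGroup : ℕ → AbelianGroup 0ℓ 0ℓ
⊕-abelianGroup n = record { isAbelianGroup = ⊕-isAbelianGroup n }

module _ {n : ℕ} where
  open AbelianGroup (⊕-abelianGroup n) public
    using ()
    renaming (assoc to ⊕-assoc; identityˡ to ⊕-identityˡ; identityʳ to ⊕-identityʳ)
  open AbelianGroupProperties (⊕-abelianGroup n) public
    using ()
    renaming (inverseˡ-unique to ⊕≡𝟎⇒≡; ∙-cancelʳ to ⊕-cancelʳ)
  open CommutativeSemigroupProperties (AbelianGroup.commutativeSemigroup (⊕-abelianGroup n)) public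
    using ()
    renaming (interchange to ⊕-interchange; x∙yz≈y∙xz to ⊕-leftComm)

≡⇒⊕≡𝟎 : ∀ {n} {x y : Z2^ n} → x ≡ y → x ⊕ y ≡ 𝟎
≡⇒⊕≡𝟎 {x = x} refl = ⊕-self x

⊕-translation-cancels : ∀ {n} (x y z w : Z2^ n) → (x ⊕ z) ⊕ ((y ⊕ z) ⊕ w) ≡ (x ⊕ y) ⊕ w
⊕-translation-cancels x y z w = begin
  (x ⊕ z) ⊕ ((y ⊕ z) ⊕ w) ≡⟨ sym (⊕-assoc (x ⊕ z) (y ⊕ z) w) ⟩
  ((x ⊕ z) ⊕ (y ⊕ z)) ⊕ w ≡⟨ cong (_⊕ w) (⊕-interchange x z y z) ⟩
  ((x ⊕ y) ⊕ (z ⊕ z)) ⊕ w ≡⟨ cong (λ v → ((x ⊕ y) ⊕ v) ⊕ w) (⊕-self z) ⟩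
  ((x ⊕ y) ⊕ 𝟎) ⊕ w       ≡⟨ cong (_⊕ w) (⊕-identityʳ (x ⊕ y)) ⟩
  (x ⊕ y) ⊕ w             ∎
  where open ≡-Reasoning

_≟_ : ∀ {n} → DecidableEquality (Z2^ n)
_≟_ = ≡-dec _≟ᵇ_

allVectors : ∀ d → List (Z2^ d)
allVectors zero    = [] ∷ []
allVectors (suc d) = map (false ∷_) (allVectors d) ++ map (true ∷_) (allVectors d)

∈-allVectors : ∀ {d} (v : Z2^ d) → v ∈ allVectors d
∈-allVectors []                  = here refl
∈-allVectors {suc d} (false ∷ v) = ∈-++⁺ˡ (∈-map⁺ (false ∷_) (∈-allVectors v))
∈-allVectors {suc d} (true ∷ v)  =
  ∈-++⁺ʳ (map (false ∷_) (allVectors d)) (∈-map⁺ (true ∷_) (∈-allVectors v))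

sum : ∀ {n} → List (Z2^ n) → Z2^ n
sum = foldr _⊕_ 𝟎

sum-++ : ∀ {n} (xs ys : List (Z2^ n)) → sum (xs ++ ys) ≡ sum xs ⊕ sum ys
sum-++ []       ys = sym (⊕-identityˡ (sum ys))
sum-++ (x ∷ xs) ys = trans (cong (x ⊕_) (sum-++ xs ys)) (sym (⊕-assoc x (sum xs) (sum ys)))

sum-translates₂ : ∀ {n} (x y z : Z2^ n) → sum ((x ⊕ z) ∷ (y ⊕ z) ∷ []) ≡ x ⊕ y
sum-translates₂ x y z = trans (⊕-translation-cancels x y z 𝟎) (⊕-identityʳ (x ⊕ y))

sum-translates₃ : ∀ {n} (x y w z : Z2^ n) →
                  sum ((x ⊕ z) ∷ (y ⊕ z) ∷ (w ⊕ z) ∷ []) ≡ (x ⊕ y) ⊕ (w ⊕ z)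
sum-translates₃ x y w z =
  trans (⊕-translation-cancels x y z _) (cong ((x ⊕ y) ⊕_) (⊕-identityʳ (w ⊕ z)))

sum-translates₄ : ∀ {n} (x y w v z : Z2^ n) →
                  sum ((x ⊕ z) ∷ (y ⊕ z) ∷ (w ⊕ z) ∷ (v ⊕ z) ∷ []) ≡ (x ⊕ y) ⊕ (w ⊕ v)
sum-translates₄ x y w v z =
  trans (⊕-translation-cancels x y z _) (cong ((x ⊕ y) ⊕_) (sum-translates₂ w v z))

weight : ∀ {n} → Z2^ n → ℕ
weight = count T?

-- Linear combinations

linComb : ∀ {n d} → Vec (Z2^ n) d → Z2^ d → Z2^ n
linComb B c = selSum c B

linComb-𝟎 : ∀ {n d} (B : Vec (Z2^ n) d) → linComb B 𝟎 ≡ 𝟎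
linComb-𝟎 []      = refl
linComb-𝟎 (_ ∷ B) = linComb-𝟎 B

linComb-⊕ : ∀ {n d} (B : Vec (Z2^ n) d) (c c′ : Z2^ d) →
            linComb B (c ⊕ c′) ≡ linComb B c ⊕ linComb B c′
linComb-⊕ []      []          []           = sym (⊕-identityʳ 𝟎)
linComb-⊕ (v ∷ B) (true ∷ c)  (true ∷ c′)  = begin
  linComb B (c ⊕ c′)                     ≡⟨ linComb-⊕ B c c′ ⟩
  linComb B c ⊕ linComb B c′             ≡⟨ sym (⊕-identityˡ _) ⟩
  𝟎 ⊕ (linComb B c ⊕ linComb B c′)       ≡⟨ cong (_⊕ _) (sym (⊕-self v)) ⟩
  (v ⊕ v) ⊕ (linComb B c ⊕ linComb B c′) ≡⟨ ⊕-interchange v v _ _ ⟩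
  (v ⊕ linComb B c) ⊕ (v ⊕ linComb B c′) ∎
  where open ≡-Reasoning
linComb-⊕ (v ∷ B) (true ∷ c)  (false ∷ c′) =
  trans (cong (v ⊕_) (linComb-⊕ B c c′)) (sym (⊕-assoc v _ _))
linComb-⊕ (v ∷ B) (false ∷ c) (true ∷ c′)  =
  trans (cong (v ⊕_) (linComb-⊕ B c c′)) (⊕-leftComm v _ _)
linComb-⊕ (v ∷ B) (false ∷ c) (false ∷ c′) = linComb-⊕ B c c′

linComb-⁅⁆ : ∀ {n d} (B : Vec (Z2^ n) d) (i : Fin d) → linComb B ⁅ i ⁆ ≡ lookup B i
linComb-⁅⁆ (v ∷ B) zero    = trans (cong (v ⊕_) (linComb-𝟎 B)) (⊕-identityʳ v)
linComb-⁅⁆ (_ ∷ B) (suc i) = linComb-⁅⁆ B i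

linComb-injective : ∀ {n d} {B : Vec (Z2^ n) d} → LinIndep B → Injective _≡_ _≡_ (linComb B)
linComb-injective {B = B} independent {c} {c′} e =
  ⊕≡𝟎⇒≡ c c′ (independent (c ⊕ c′) (trans (linComb-⊕ B c c′) (≡⇒⊕≡𝟎 e)))

sum-map-linComb : ∀ {n d} (B : Vec (Z2^ n) d) (xs : List (Z2^ d)) →
                  sum (map (linComb B) xs) ≡ linComb B (sum xs)
sum-map-linComb B []       = sym (linComb-𝟎 B)
sum-map-linComb B (x ∷ xs) =
  trans (cong (linComb B x ⊕_) (sum-map-linComb B xs)) (sym (linComb-⊕ B x (sum xs)))

inSpan? : ∀ {n d} (B : Vec (Z2^ n) d) (v : Z2^ n) → Dec (InSpan B v)
inSpan? B v = map′ satisfied (λ (c , e) → lose (∈-allVectors c) e)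
                   (any? (λ c → linComb B c ≟ v) (allVectors _))

LinIndep-∷ : ∀ {n d} {B : Vec (Z2^ n) d} {x} → LinIndep B → ¬ InSpan B x → LinIndep (x ∷ B)
LinIndep-∷ {x = x} _ x∉ (true ∷ c) e = contradiction (c , sym (⊕≡𝟎⇒≡ x _ e)) x∉
LinIndep-∷ independent _ (false ∷ c) e = cong (false ∷_) (independent c e)

-- Independent vectors in Z2^ n number at most n

2^_ : ℕ → ℕ
2^ zero  = 1
2^ suc r = 2^ r + 2^ r

toFin : ∀ {r} → Z2^ r → Fin (2^ r)
toFin []                  = zero
toFin {suc r} (false ∷ x) = toFin x ↑ˡ 2^ r
toFin {suc r} (true ∷ x)  = 2^ r ↑ʳ toFin x

fromFin : ∀ r → Fin (2^ r) → Z2^ r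
fromFin zero    _ = []
fromFin (suc r) i = [ (false ∷_) ∘ fromFin r , (true ∷_) ∘ fromFin r ]′ (splitAt (2^ r) i)

fromFin-toFin : ∀ {r} (x : Z2^ r) → fromFin r (toFin x) ≡ x
fromFin-toFin []                  = refl
fromFin-toFin {suc r} (false ∷ x) rewrite splitAt-↑ˡ (2^ r) (toFin x) (2^ r) =
  cong (false ∷_) (fromFin-toFin x)
fromFin-toFin {suc r} (true ∷ x)  rewrite splitAt-↑ʳ (2^ r) (2^ r) (toFin x) =
  cong (true ∷_) (fromFin-toFin x)

toFin-fromFin : ∀ r (i : Fin (2^ r)) → toFin (fromFin r i) ≡ i
toFin-fromFin zero    zero = refl
toFin-fromFin (suc r) i with splitAt (2^ r) i in eq
... | inj₁ j = trans (cong (_↑ˡ 2^ r) (toFin-fromFin r j)) (splitAt⁻¹-↑ˡ eq)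
... | inj₂ j = trans (cong (2^ r ↑ʳ_) (toFin-fromFin r j)) (splitAt⁻¹-↑ʳ eq)

2^-positive : ∀ r → 1 ≤ 2^ r
2^-positive zero    = ≤-refl
2^-positive (suc r) = ≤-trans (2^-positive r) (m≤m+n (2^ r) (2^ r))

2^-mono-≤ : ∀ {m r} → m ≤ r → 2^ m ≤ 2^ r
2^-mono-≤ {r = r} z≤n = 2^-positive r
2^-mono-≤ (s≤s m≤r)   = +-mono-≤ (2^-mono-≤ m≤r) (2^-mono-≤ m≤r)

2^-cancel-≤ : ∀ {r m} → 2^ r ≤ 2^ m → r ≤ m
2^-cancel-≤ {r} {m} 2^r≤2^m with r ≤? m
... | yes r≤m = r≤m
... | no r≰m  = contradiction 2^r≤2^m (<⇒≱ (≤-trans 2^m<2^[1+m] (2^-mono-≤ (≰⇒> r≰m))))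
  where
  2^m<2^[1+m] : 2^ m < 2^ suc m
  2^m<2^[1+m] = +-mono-≤ (2^-positive m) ≤-refl

injection⇒≤ : ∀ {r m} (f : Z2^ r → Z2^ m) → Injective _≡_ _≡_ f → r ≤ m
injection⇒≤ {r} {m} f f-injective =
  2^-cancel-≤ (Fin-injective⇒≤ {f = toFin ∘ f ∘ fromFin r} g-injective)
  where
  toFin-injective : ∀ {x y : Z2^ m} → toFin x ≡ toFin y → x ≡ y
  toFin-injective {x} {y} e =
    trans (sym (fromFin-toFin x)) (trans (cong (fromFin m) e) (fromFin-toFin y))
  g-injective : Injective _≡_ _≡_ (toFin ∘ f ∘ fromFin r)
  g-injective {i} {j} e =
    trans (sym (toFin-fromFin r i))
          (trans (cong toFin (f-injective (toFin-injective e))) (toFin-fromFin r j))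

LinIndep⇒≤ : ∀ {n d} {B : Vec (Z2^ n) d} → LinIndep B → d ≤ n
LinIndep⇒≤ independent = injection⇒≤ _ (linComb-injective independent)

-- Extracting a basis

record BasisSplit {m} (U : List (Z2^ m)) : Set where
  constructor basisSplit
  field
    basis others   : List (Z2^ m)
    independent    : LinIndep (fromList basis)
    spanned        : All (InSpan (fromList basis)) others
    basis++others↭ : basis ++ others ↭ U

splitBasis : ∀ {m} (U : List (Z2^ m)) → BasisSplit U
splitBasis []      = basisSplit [] [] (λ { [] _ → refl }) [] ↭-refl
splitBasis (x ∷ U) = insert (splitBasis U)
  where
  insert : BasisSplit U → BasisSplit (x ∷ U)
  insert (basisSplit P R independent spanned P++R↭U) with inSpan? (fromList P) x
  ... | yes x∈span = basisSplit P (x ∷ R) independent (x∈span ∷ spanned)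
                                (↭-trans (↭-shift P R) (↭-prep x P++R↭U))
  ... | no x∉span  = basisSplit (x ∷ P) R (LinIndep-∷ independent x∉span)
                                (All.map (λ (c , e) → false ∷ c , e) spanned) (↭-prep x P++R↭U)

-- Four-wise independence

EverySmallSubset : ∀ {A : Set} → (List A → Set) → List A → Set
EverySmallSubset P W = ∀ xs → xs ⊆ W → Unique xs → 1 ≤ length xs → length xs ≤ 4 → P xs

everySmallSubset-⊆ : ∀ {A : Set} {P : List A → Set} {V W} →
                     V ⊆ W → EverySmallSubset P W → EverySmallSubset P V
everySmallSubset-⊆ V⊆W all-P xs xs⊆V = all-P xs (V⊆W ∘ xs⊆V)

FourWiseIndependent : ∀ {n} → List (Z2^ n) → Set
FourWiseIndependent = EverySmallSubset (λ xs → sum xs ≢ 𝟎)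

fourWiseIndependent-linComb : ∀ {n d} {B : Vec (Z2^ n) d} {W} → LinIndep B →
                              FourWiseIndependent (map (linComb B) W) → FourWiseIndependent W
fourWiseIndependent-linComb {B = B} independent all-nonzero xs xs⊆W xs-unique 1≤|xs| |xs|≤4 sum≡𝟎 =
  all-nonzero (map (linComb B) xs) (Subset.map⁺ (linComb B) xs⊆W)
    (Unique.map⁺ (linComb-injective independent) xs-unique)
    (subst (1 ≤_) (sym (length-map _ xs)) 1≤|xs|) (subst (_≤ 4) (sym (length-map _ xs)) |xs|≤4)
    (trans (sum-map-linComb B xs) (trans (cong (linComb B) sum≡𝟎) (linComb-𝟎 B)))

-- A cap in affine coordinates

differences : ∀ {n k} → (Fin (suc k) → Z2^ n) → List (Z2^ n)
differences S = tabulate (λ i → S (suc i) ⊕ S zero)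

differences-unique : ∀ {n k} {S : Fin (suc k) → Z2^ n} → Injective _≡_ _≡_ S →
                     Unique (differences S)
differences-unique S-injective =
  Unique.tabulate⁺ (λ e → suc-injective (S-injective (⊕-cancelʳ _ _ _ e)))

cap⇒differences-fourWiseIndependent : ∀ {n k} {S : Fin (suc k) → Z2^ n} →
                                      IsKCap (suc k) S → FourWiseIndependent (differences S)
cap⇒differences-fourWiseIndependent {n} {k} {S} (S-injective , cap) = independent
  where
  D : Fin k → Z2^ n
  D i = S (suc i) ⊕ S zero
  index : ∀ {x} → x ∈ differences S → ∃ λ i → x ≡ D i
  index = ∈-tabulate⁻
  suc≢ : ∀ {i j} → D i ≢ D j → Fin.suc i ≢ suc j
  suc≢ D-distinct refl = D-distinct refl
  independent : FourWiseIndependent (differences S)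
  independent (x ∷ []) xs⊆ _ _ _ sum≡𝟎
    with i , refl ← index (xs⊆ (here refl))
    with () ← S-injective (⊕≡𝟎⇒≡ _ _ (trans (sym (⊕-identityʳ (D i))) sum≡𝟎))
  independent (x ∷ y ∷ []) xs⊆ ((x≢y ∷ []) ∷ _) _ _ sum≡𝟎
    with i , refl ← index (xs⊆ (here refl))
    with j , refl ← index (xs⊆ (there (here refl))) =
    suc≢ x≢y (S-injective (⊕≡𝟎⇒≡ _ _ (trans (sym (sum-translates₂ _ _ _)) sum≡𝟎)))
  independent (x ∷ y ∷ z ∷ []) xs⊆ ((x≢y ∷ x≢z ∷ []) ∷ (y≢z ∷ []) ∷ _) _ _ sum≡𝟎
    with i , refl ← index (xs⊆ (here refl))
    with j , refl ← index (xs⊆ (there (here refl)))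
    with l , refl ← index (xs⊆ (there (there (here refl)))) =
    cap (suc i) (suc j) (suc l) zero (suc≢ x≢y) (suc≢ x≢z) (λ ()) (suc≢ y≢z) (λ ()) (λ ())
        (trans (sym (sum-translates₃ _ _ _ _)) sum≡𝟎)
  independent (x ∷ y ∷ z ∷ w ∷ []) xs⊆
              ((x≢y ∷ x≢z ∷ x≢w ∷ []) ∷ (y≢z ∷ y≢w ∷ []) ∷ (z≢w ∷ []) ∷ _) _ _ sum≡𝟎
    with i , refl ← index (xs⊆ (here refl))
    with j , refl ← index (xs⊆ (there (here refl)))
    with l , refl ← index (xs⊆ (there (there (here refl))))
    with o , refl ← index (xs⊆ (there (there (there (here refl))))) =
    cap (suc i) (suc j) (suc l) (suc o)
        (suc≢ x≢y) (suc≢ x≢z) (suc≢ x≢w) (suc≢ y≢z) (suc≢ y≢w) (suc≢ z≢w)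
        (trans (sym (sum-translates₄ _ _ _ _ _)) sum≡𝟎)
  independent (_ ∷ _ ∷ _ ∷ _ ∷ _ ∷ _) _ _ _ (s≤s (s≤s (s≤s (s≤s ())))) _

InAff-point : ∀ {n k} (S : Fin k → Z2^ n) (i : Fin k) → InAff S (S i)
InAff-point S i =
  ⁅ i ⁆ , cong (_% 2) (∣⁅x⁆∣≡1 i) , trans (linComb-⁅⁆ (Vec.tabulate S) i) (lookup∘tabulate S i)

capInCoordinates : ∀ {n k d} {S : Fin (suc k) → Z2^ n} → IsKCap (suc k) S → AffDim S d →
                   ∃ λ (U : List (Z2^ d)) → length U ≡ k × Unique U × FourWiseIndependent U
capInCoordinates {n} {k} {d} {S} cap@(S-injective , _) (B , independent , _ , spanning) =
    U , |U| , Unique.map⁻ (subst Unique (sym U↦differences) (differences-unique S-injective))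
  , fourWiseIndependent-linComb independent
      (subst FourWiseIndependent (sym U↦differences) (cap⇒differences-fourWiseIndependent cap))
  where
  coordinates : ∃ λ U → map (linComb B) U ≡ differences S
  coordinates = preimage (linComb B) (All-tabulate⁺ λ i →
    spanning _ (S (suc i) , S zero , InAff-point S (suc i) , InAff-point S zero , refl))
  U : List (Z2^ d)
  U = proj₁ coordinates
  U↦differences : map (linComb B) U ≡ differences S
  U↦differences = proj₂ coordinates
  |U| : length U ≡ k
  |U| = trans (sym (length-map (linComb B) U))
              (trans (cong length U↦differences) (length-tabulate _))

-- Standard form

units : ∀ d → List (Z2^ d)
units zero    = []
units (suc d) = (true ∷ 𝟎) ∷ map (false ∷_) (units d)

map-linComb-units : ∀ {n d} (B : Vec (Z2^ n) d) → map (linComb B) (units d) ≡ toList B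
map-linComb-units []      = refl
map-linComb-units (v ∷ B) =
  cong₂ _∷_ (trans (cong (v ⊕_) (linComb-𝟎 B)) (⊕-identityʳ v))
            (trans (sym (map-∘ (units _))) (map-linComb-units B))

standardForm : ∀ {m} (U : List (Z2^ m)) → Unique U → FourWiseIndependent U →
               ∃₂ λ r (Y : List (Z2^ r)) →
                 r ≤ m × length Y ≡ length U ∸ r
                 × Unique (units r ++ Y) × FourWiseIndependent (units r ++ Y)
standardForm {m} U U-unique U-independent =
    length basis , Y , LinIndep⇒≤ independent , |Y|
  , Unique.map⁻ (Unique-resp-↭ (↭-sym image↭U) U-unique)
  , fourWiseIndependent-linComb independent (everySmallSubset-⊆ (∈-resp-↭ image↭U) U-independent)
  where
  open BasisSplit (splitBasis U)
  open ≡-Reasoning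
  B : Vec (Z2^ m) (length basis)
  B = fromList basis
  coordinates : ∃ λ Y → map (linComb B) Y ≡ others
  coordinates = preimage (linComb B) spanned
  Y : List (Z2^ (length basis))
  Y = proj₁ coordinates
  image↭U : map (linComb B) (units (length basis) ++ Y) ↭ U
  image↭U = subst (_↭ U) (sym (begin
    map (linComb B) (units _ ++ Y)                   ≡⟨ map-++ _ (units _) Y ⟩
    map (linComb B) (units _) ++ map (linComb B) Y  ≡⟨ cong₂ _++_ (trans (map-linComb-units B)
                                                                          (toList∘fromList basis))
                                                                   (proj₂ coordinates) ⟩
    basis ++ others                                  ∎)) basis++others↭
  |Y| : length Y ≡ length U ∸ length basis
  |Y| = begin
    length Y                                      ≡⟨ sym (length-map (linComb B) Y) ⟩
    length (map (linComb B) Y)                    ≡⟨ cong length (proj₂ coordinates) ⟩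
    length others                                 ≡⟨ sym (m+n∸m≡n (length basis) (length others)) ⟩
    length basis + length others ∸ length basis  ≡⟨ cong (_∸ length basis)
                                                       (trans (sym (length-++ basis))
                                                              (xs↭ys⇒|xs|≡|ys| basis++others↭)) ⟩
    length U ∸ length basis                       ∎

support : ∀ {r} → Z2^ r → List (Z2^ r)
support []          = []
support (true ∷ x)  = (true ∷ 𝟎) ∷ map (false ∷_) (support x)
support (false ∷ x) = map (false ∷_) (support x)

support-⊆ : ∀ {r} (x : Z2^ r) → support x ⊆ units r
support-⊆ (true ∷ x)  (here refl) = here refl
support-⊆ (true ∷ x)  (there e∈)  = there (Subset.map⁺ (false ∷_) (support-⊆ x) e∈)
support-⊆ (false ∷ x) e∈          = there (Subset.map⁺ (false ∷_) (support-⊆ x) e∈)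

support-unique : ∀ {r} (x : Z2^ r) → Unique (support x)
support-unique []          = []
support-unique (true ∷ x)  =
  All-map⁺ (All.universal (λ _ ()) (support x)) ∷ Unique.map⁺ ∷-injectiveʳ (support-unique x)
support-unique (false ∷ x) = Unique.map⁺ ∷-injectiveʳ (support-unique x)

support-length : ∀ {r} (x : Z2^ r) → length (support x) ≡ weight x
support-length []          = refl
support-length (true ∷ x)  = cong suc (trans (length-map _ (support x)) (support-length x))
support-length (false ∷ x) = trans (length-map _ (support x)) (support-length x)

sum-map-false∷ : ∀ {r} (xs : List (Z2^ r)) → sum (map (false ∷_) xs) ≡ false ∷ sum xs
sum-map-false∷ []       = refl
sum-map-false∷ (x ∷ xs) = cong ((false ∷ x) ⊕_) (sum-map-false∷ xs)

support-sum : ∀ {r} (x : Z2^ r) → sum (support x) ≡ x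
support-sum []          = refl
support-sum (true ∷ x)  = trans (cong ((true ∷ 𝟎) ⊕_) (sum-map-false∷ (support x)))
                                (cong (true ∷_) (trans (⊕-identityˡ _) (support-sum x)))
support-sum (false ∷ x) = trans (sum-map-false∷ (support x)) (cong (false ∷_) (support-sum x))

Heavy : ∀ {r} → List (Z2^ r) → Set
Heavy xs = 5 ≤ weight (sum xs) + length xs

heavy? : ∀ {r} (xs : List (Z2^ r)) → Dec (Heavy xs)
heavy? xs = 5 ≤? weight (sum xs) + length xs

-- A light xs, together with the unit vectors in the support of its sum, is a set of at most
-- four elements of units r ++ Y with sum 𝟎.
fourWiseIndependent⇒heavy : ∀ {r} {Y : List (Z2^ r)} → Unique (units r ++ Y) →
                            FourWiseIndependent (units r ++ Y) → EverySmallSubset Heavy Y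
fourWiseIndependent⇒heavy {r} {Y} units++Y-unique independent xs xs⊆Y xs-unique 1≤|xs| _
  with heavy? xs
... | yes heavy = heavy
... | no light  = contradiction sum≡𝟎
      (independent (es ++ xs) (Subset.++⁺ (support-⊆ s) xs⊆Y)
                   (Unique.++⁺ (support-unique s) xs-unique disjoint)
                   (≤-trans 1≤|xs| (length-++-≤ʳ xs {es})) |es++xs|≤4)
  where
  s : Z2^ r
  s = sum xs
  es : List (Z2^ r)
  es = support s
  disjoint : ∀ {v} → ¬ (v ∈ es × v ∈ xs)
  disjoint (v∈es , v∈xs) =
    unique-++-disjoint (units r) units++Y-unique (support-⊆ s v∈es) (xs⊆Y v∈xs) refl
  |es++xs|≤4 : length (es ++ xs) ≤ 4
  |es++xs|≤4 = subst (_≤ 4) (sym (trans (length-++ es) (cong (_+ length xs) (support-length s))))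
                     (≤-pred (≰⇒> light))
  sum≡𝟎 : sum (es ++ xs) ≡ 𝟎
  sum≡𝟎 = trans (sum-++ es xs) (trans (cong (_⊕ s) (support-sum s)) (⊕-self s))

-- Exhaustive search

Addable : ∀ {r} → List (Z2^ r) → Z2^ r → Z2^ r → Set
Addable X h y = Heavy (h ∷ y ∷ [])
              × All (λ a → Heavy (a ∷ h ∷ y ∷ [])) X
              × All (λ a → All (λ b → a ≢ b → Heavy (a ∷ b ∷ h ∷ y ∷ [])) X) X

addable? : ∀ {r} (X : List (Z2^ r)) (h y : Z2^ r) → Dec (Addable X h y)
addable? X h y = heavy? (h ∷ y ∷ [])
           ×-dec all? (λ a → heavy? (a ∷ h ∷ y ∷ [])) X
           ×-dec all? (λ a → all? (λ b → ¬? (a ≟ b) →-dec heavy? (a ∷ b ∷ h ∷ y ∷ [])) X) X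

addable : ∀ {r} {h : Z2^ r} {X Y y} → Unique (h ∷ X ++ Y) → EverySmallSubset Heavy (h ∷ X ++ Y) →
          y ∈ Y → Addable X h y
addable {h = h} {X} {Y} {y} (h∉ ∷ X++Y-unique) heavy y∈Y =
    heavy (h ∷ y ∷ [])
          (λ { (here refl) → here refl ; (there (here refl)) → there y∈ })
          ((h≢ y∈ ∷ []) ∷ [] ∷ []) (s≤s z≤n) (s≤s (s≤s z≤n))
  , All.tabulate (λ {a} a∈X →
      heavy (a ∷ h ∷ y ∷ [])
            (λ { (here refl) → there (∈-++⁺ˡ a∈X) ; (there (here refl)) → here refl
               ; (there (there (here refl))) → there y∈ })
            ((≢h a∈X ∷ ≢y a∈X ∷ []) ∷ (h≢ y∈ ∷ []) ∷ [] ∷ []) (s≤s z≤n) (s≤s (s≤s (s≤s z≤n))))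
  , All.tabulate (λ {a} a∈X → All.tabulate (λ {b} b∈X a≢b →
      heavy (a ∷ b ∷ h ∷ y ∷ [])
            (λ { (here refl) → there (∈-++⁺ˡ a∈X) ; (there (here refl)) → there (∈-++⁺ˡ b∈X)
               ; (there (there (here refl))) → here refl
               ; (there (there (there (here refl)))) → there y∈ })
            ((a≢b ∷ ≢h a∈X ∷ ≢y a∈X ∷ []) ∷ (≢h b∈X ∷ ≢y b∈X ∷ []) ∷ (h≢ y∈ ∷ []) ∷ [] ∷ [])
            (s≤s z≤n) ≤-refl))
  where
  y∈ : y ∈ X ++ Y
  y∈ = ∈-++⁺ʳ X y∈Y
  h≢ : ∀ {z} → z ∈ X ++ Y → h ≢ z
  h≢ = All.lookup h∉
  ≢h : ∀ {a} → a ∈ X → a ≢ h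
  ≢h a∈X = h≢ (∈-++⁺ˡ a∈X) ∘ sym
  ≢y : ∀ {a} → a ∈ X → a ≢ y
  ≢y a∈X = unique-++-disjoint X X++Y-unique a∈X y∈Y

-- Once h is chosen, only the later candidates y with Addable X h y are kept: these are the
-- conditions on the small subsets whose last two chosen elements are h and y.
cannotExtend : ∀ {r} → List (Z2^ r) → ℕ → List (Z2^ r) → Bool
cannotExtend X zero    _           = false
cannotExtend X (suc k) []          = true
cannotExtend X (suc k) (h ∷ cands) =
  cannotExtend (h ∷ X) k (filter (addable? X h) cands) ∧ cannotExtend X (suc k) cands

CannotExtendSound : ℕ → ℕ → Set
CannotExtendSound r k =
  ∀ (X cands Y : List (Z2^ r)) → cannotExtend X k cands ≡ true →
  length Y ≡ k → Y ⊆ cands → Unique (X ++ Y) → EverySmallSubset Heavy (X ++ Y) → ⊥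

cannotExtend-sound-suc : ∀ {r k} → CannotExtendSound r k → CannotExtendSound r (suc k)
cannotExtend-sound-suc IH X []          []      _  () _ _ _
cannotExtend-sound-suc IH X []          (y ∷ Y) _  _  Y⊆ _ _ with () ← Y⊆ (here refl)
cannotExtend-sound-suc IH X (h ∷ cands) Y       ok |Y| Y⊆ X++Y-unique heavy with any? (h ≟_) Y
... | no h∉Y = cannotExtend-sound-suc IH X cands Y (∧-conicalʳ _ _ ok) |Y| Y⊆cands X++Y-unique heavy
  where
  Y⊆cands : Y ⊆ cands
  Y⊆cands y∈Y with Y⊆ y∈Y
  ... | here refl     = contradiction (lose y∈Y refl) h∉Y
  ... | there y∈cands = y∈cands
... | yes h∈Y with ys , zs , refl ← ∈-∃++ h∈Y =
  IH (h ∷ X) (filter (addable? X h) cands) (ys ++ zs) (∧-conicalˡ _ _ ok)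
     (ℕ-suc-injective (trans (sym (length-++-sucʳ ys h zs)) |Y|)) Y′⊆ h∷X++Y′-unique h∷X++Y′-heavy
  where
  reorder : X ++ ys ++ h ∷ zs ↭ h ∷ X ++ ys ++ zs
  reorder = ↭-trans (++⁺ˡ X (↭-shift ys zs)) (↭-shift X (ys ++ zs))
  h∷X++Y′-unique : Unique (h ∷ X ++ ys ++ zs)
  h∷X++Y′-unique = Unique-resp-↭ reorder X++Y-unique
  h∷X++Y′-heavy : EverySmallSubset Heavy (h ∷ X ++ ys ++ zs)
  h∷X++Y′-heavy = everySmallSubset-⊆ (∈-resp-↭ (↭-sym reorder)) heavy
  Y′⊆ : ys ++ zs ⊆ filter (addable? X h) cands
  Y′⊆ y∈Y′ with Y⊆ (∈-resp-↭ (↭-sym (↭-shift ys zs)) (there y∈Y′)) | h∷X++Y′-unique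
  ... | here refl     | h∉ ∷ _ = contradiction refl (All.lookup h∉ (∈-++⁺ʳ X y∈Y′))
  ... | there y∈cands | _      =
    ∈-filter⁺ (addable? X h) y∈cands (addable h∷X++Y′-unique h∷X++Y′-heavy y∈Y′)

cannotExtend-sound : ∀ {r} k → CannotExtendSound r k
cannotExtend-sound zero    _ _ _ ()
cannotExtend-sound (suc k) = cannotExtend-sound-suc (cannotExtend-sound k)

candidates : ∀ r → List (Z2^ r)
candidates r = filter (λ v → heavy? (v ∷ [])) (allVectors r)

exhaustiveSearch : ∀ r → r ≤ 7 → cannotExtend [] (12 ∸ r) (candidates r) ≡ true
exhaustiveSearch 0 _ = refl
exhaustiveSearch 1 _ = refl
exhaustiveSearch 2 _ = refl
exhaustiveSearch 3 _ = refl
exhaustiveSearch 4 _ = refl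
exhaustiveSearch 5 _ = refl
exhaustiveSearch 6 _ = refl
exhaustiveSearch 7 _ = refl
exhaustiveSearch (suc (suc (suc (suc (suc (suc (suc (suc _))))))))
                 (s≤s (s≤s (s≤s (s≤s (s≤s (s≤s (s≤s ())))))))

noHeavyFamily : ∀ {r} → r ≤ 7 → (Y : List (Z2^ r)) → length Y ≡ 12 ∸ r → Unique Y →
                EverySmallSubset Heavy Y → ⊥
noHeavyFamily {r} r≤7 Y |Y| Y-unique heavy =
  cannotExtend-sound (12 ∸ r) [] (candidates r) Y (exhaustiveSearch r r≤7)
                     |Y| Y⊆candidates Y-unique heavy
  where
  Y⊆candidates : Y ⊆ candidates r
  Y⊆candidates y∈Y = ∈-filter⁺ (λ v → heavy? (v ∷ [])) (∈-allVectors _)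
    (heavy (_ ∷ []) (λ { (here refl) → y∈Y }) ([] ∷ []) (s≤s z≤n) (s≤s z≤n))

theorem8p2 : (n : ℕ) (S : Fin 13 → Z2^ n) → ¬ (IsKCap 13 S × AffDim S 7)
theorem8p2 n S (cap , dim) =
  let U , |U| , U-unique , U-independent = capInCoordinates cap dim
      r , Y , r≤7 , |Y| , Z-unique , Z-independent = standardForm U U-unique U-independent
  in  noHeavyFamily r≤7 Y (trans |Y| (cong (_∸ r) |U|)) (unique-++ʳ (units r) Z-unique)
                    (fourWiseIndependent⇒heavy Z-unique Z-independent)
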